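{- Let $n\ge2$ and let $T^{gfb}_n=(T_a,T_b)$ be the GFB tree with $n$ leaves, where $T_a$ and $T_b$ have $n_a$ and $n_b$ leaves. Then $T_a$ and $T_b$ are also GFB trees, i.e. $T_a=T^{gfb}_{n_a}$ and $T_b=T^{gfb}_{n_b}$.
   Context: A rooted binary tree with $n\ge2$ leaves is a rooted tree in which the root has degree 2 and every other internal vertex has degree 3 (each internal vertex has exactly two children); the single vertex is the rooted binary tree with one leaf. $T=(T_a,T_b)$ denotes the decomposition into the subtrees rooted at the two children of the root. The GFB tree $T^{gfb}_n$ is the output (up to isomorphism) of the algorithm: start with $n$ single-vertex trees; while more than one tree remains, remove a tree $u$ with minimum number of leaves, then a tree $v$ with minimum number of leaves among the remaining, and add the tree with a new root whose children are the roots of $u$ and $v$; output the remaining tree. -}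

module Defs where

open import Data.Nat using (ℕ; zero; suc; _+_; _≤_)
open import Data.List using (List; []; _∷_; replicate)
open import Data.List.Relation.Unary.All using (All)
open import Data.List.Relation.Binary.Permutation.Propositional using (_↭_)
open import Data.Product using (_×_)
open import Data.Sum using (_⊎_)
open import Relation.Binary.Construct.Closure.ReflexiveTransitive using (Star)

-- Rooted binary trees (each internal vertex has exactly two children).
-- The children are stored in an order, but trees are compared up to
-- isomorphism (_≅_ below), which forgets this order.
data Tree : Set where
  leaf : Tree
  node : Tree → Tree → Tree

leaves : Tree → ℕ
leaves leaf = 1
leaves (node a b) = leaves a + leaves b

data _≅_ : Tree → Tree → Set where
  leaf≅ : leaf ≅ leaf
  node≅ : ∀ {a b c d} → (a ≅ c × b ≅ d) ⊎ (a ≅ d × b ≅ c) → node a b ≅ node c d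

-- One step of the GFB algorithm on a multiset (list up to permutation) of trees:
-- remove a tree u with minimum number of leaves, then a tree v with minimum
-- number of leaves among the remaining ones, and add the tree with a new root
-- whose children are u and v.
data GFBStep : List Tree → List Tree → Set where
  step : ∀ {xs} u v rest →
         xs ↭ (u ∷ v ∷ rest) →
         All (λ t → leaves u ≤ leaves t) (v ∷ rest) →
         All (λ t → leaves v ≤ leaves t) rest →
         GFBStep xs (node u v ∷ rest)

-- T is a possible output of the GFB algorithm started with n single-vertex trees.
-- (The algorithm stops exactly when one tree remains; every step strictly
-- decreases the number of trees, so a run reaching a singleton is a full run.)
IsGFB : ℕ → Tree → Set
IsGFB n T = Star GFBStep (replicate n leaf) (T ∷ [])

-- The GFB tree is the output of the last merge, so its two subtrees are
-- the only members of the forest one step before the end.  The heart of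
-- the proof is that every sub-multiset of a forest produced by the
-- algorithm is itself produced by the algorithm (from fewer leaves): a
-- merge either happens entirely inside the chosen sub-multiset, where it
-- is still a legal step because minimality passes to sub-multisets, or it
-- happens entirely outside it and can be ignored.  A forest consisting of
-- a single tree T is then reached from exactly leaves T leaves, since the
-- total number of leaves never changes.
module Submission where

open import Defs
open import Data.Nat using (ℕ; _≤_; suc)
open import Data.Nat.Properties using (+-assoc; +-identityʳ)
open import Data.Nat.ListAction using (sum)
open import Data.Nat.ListAction.Properties using (sum-↭)
open import Data.Product using (Σ; ∃-syntax; _×_; _,_)
open import Data.Empty using (⊥-elim)
open import Data.Sum using (_⊎_; inj₁; inj₂)
open import Data.List using (List; []; _∷_; _++_; [_]; replicate; length; map)
open import Data.List.Relation.Unary.All using (All; _∷_; [])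
open import Data.List.Relation.Unary.All.Properties using (++⁻ˡ; replicate⁺)
open import Data.List.Relation.Unary.Any using (here)
open import Data.List.Membership.Propositional.Properties using (∈-++⁻; ∈-∃++)
open import Data.List.Relation.Binary.Permutation.Propositional
  using (_↭_; prep; swap; ↭-refl; ↭-reflexive; ↭-sym; ↭-trans)
open import Data.List.Relation.Binary.Permutation.Propositional.Properties
  using (All-resp-↭; ∈-resp-↭; ↭-singleton-inv; shift; shifts; drop-∷; ++⁺ʳ; ++⁺ˡ; map⁺)
open import Relation.Binary.Core using (Rel)
open import Relation.Binary.Construct.Closure.ReflexiveTransitive
  using (Star; ε; _◅_; _◅◅_; fold)
open import Relation.Binary.PropositionalEquality
  using (_≡_; _≢_; refl; sym; trans; cong; subst)

≅-refl : ∀ T → T ≅ T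
≅-refl leaf       = leaf≅
≅-refl (node a b) = node≅ (inj₁ (≅-refl a , ≅-refl b))

All-≡⇒≡replicate : ∀ {a} {A : Set a} {x : A} {xs : List A} →
                   All (_≡ x) xs → xs ≡ replicate (length xs) x
All-≡⇒≡replicate []           = refl
All-≡⇒≡replicate (refl ∷ x≡s) = cong (_ ∷_) (All-≡⇒≡replicate x≡s)

Star-unsnoc : ∀ {i t} {I : Set i} {T : Rel I t} {x z : I} → Star T x z →
              x ≡ z ⊎ ∃[ y ] (Star T x y × T y z)
Star-unsnoc ε = inj₁ refl
Star-unsnoc (s ◅ ss) with Star-unsnoc ss
... | inj₁ refl            = inj₂ (_ , ε , s)
... | inj₂ (y , ss′ , s′) = inj₂ (y , s ◅ ss′ , s′)

leafCount : List Tree → ℕ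
leafCount ts = sum (map leaves ts)

leafCount-replicate : ∀ k → leafCount (replicate k leaf) ≡ k
leafCount-replicate 0       = refl
leafCount-replicate (suc k) = cong suc (leafCount-replicate k)

leafCount-step : ∀ {ws ws′} → GFBStep ws ws′ → leafCount ws ≡ leafCount ws′
leafCount-step (step u v rest p _ _) =
  trans (sum-↭ (map⁺ leaves p)) (sym (+-assoc (leaves u) (leaves v) (leafCount rest)))

leafCount-run : ∀ {ws ws′} → Star GFBStep ws ws′ → leafCount ws ≡ leafCount ws′
leafCount-run = fold (λ ws ws′ → leafCount ws ≡ leafCount ws′)
                     (λ s eq → trans (leafCount-step s) eq) refl

Reachable : List Tree → Set
Reachable ts = Σ ℕ λ k → Σ (List Tree) λ ts′ →
               Star GFBStep (replicate k leaf) ts′ × ts′ ↭ ts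

Reachable-resp-↭ : ∀ {ts us} → ts ↭ us → Reachable ts → Reachable us
Reachable-resp-↭ σ (k , ts′ , run , τ) = k , ts′ , run , ↭-trans τ σ

Reachable-step : ∀ {u v zs} → Reachable (u ∷ v ∷ zs) →
                 All (λ t → leaves u ≤ leaves t) (v ∷ zs) →
                 All (λ t → leaves v ≤ leaves t) zs →
                 Reachable (node u v ∷ zs)
Reachable-step {u} {v} {zs} (k , ts′ , run , σ) u-min v-min =
  k , node u v ∷ zs , run ◅◅ (step u v zs σ u-min v-min ◅ ε) , ↭-refl

Reachable-singleton⇒IsGFB : ∀ {T} → Reachable [ T ] → IsGFB (leaves T) T
Reachable-singleton⇒IsGFB {T} (k , ts′ , run , σ) with ↭-singleton-inv σ
... | refl = subst (λ m → IsGFB m T) k≡leaves run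
  where
  k≡leaves : k ≡ leaves T
  k≡leaves = trans (sym (leafCount-replicate k))
                   (trans (leafCount-run run) (+-identityʳ (leaves T)))

SubforestsReachable : List Tree → Set
SubforestsReachable ws = ∀ xs ys → ws ↭ xs ++ ys → Reachable xs

SubforestsReachable-replicate : ∀ n → SubforestsReachable (replicate n leaf)
SubforestsReachable-replicate n xs ys σ =
  length xs , replicate (length xs) leaf , ε ,
  ↭-reflexive (sym (All-≡⇒≡replicate (++⁻ˡ xs (All-resp-↭ σ (replicate⁺ n refl)))))

SubforestsReachable-step : ∀ {ws ws′} → SubforestsReachable ws → GFBStep ws ws′ →
                           SubforestsReachable ws′
SubforestsReachable-step sub (step u v rest p (u≤v ∷ u≤rest) v-min) xs ys σ
  with ∈-++⁻ xs (∈-resp-↭ σ (here refl))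
... | inj₁ uv∈xs with ∈-∃++ uv∈xs
...   | h , t , refl =
  Reachable-resp-↭ (↭-sym (shift (node u v) h t))
    (Reachable-step (sub (u ∷ v ∷ h ++ t) ys (↭-trans p (prep u (prep v rest↭))))
                    (u≤v ∷ ++⁻ˡ (h ++ t) (All-resp-↭ rest↭ u≤rest))
                    (++⁻ˡ (h ++ t) (All-resp-↭ rest↭ v-min)))
  where
  rest↭ : rest ↭ (h ++ t) ++ ys
  rest↭ = drop-∷ (↭-trans σ (++⁺ʳ ys (shift (node u v) h t)))
SubforestsReachable-step sub (step u v rest p _ _) xs ys σ
  | inj₂ uv∈ys with ∈-∃++ uv∈ys
...   | h , t , refl =
  sub xs (u ∷ v ∷ h ++ t)
    (↭-trans p (↭-trans (prep u (prep v rest↭)) (shifts (u ∷ v ∷ []) xs)))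
  where
  rest↭ : rest ↭ xs ++ h ++ t
  rest↭ = drop-∷ (↭-trans σ (↭-trans (++⁺ˡ xs (shift (node u v) h t))
                                      (shift (node u v) xs (h ++ t))))

Reachable-++⁻ˡ : ∀ xs {ys} → Reachable (xs ++ ys) → Reachable xs
Reachable-++⁻ˡ xs {ys} (k , ts′ , run , σ) =
  fold (λ ws ws′ → SubforestsReachable ws → SubforestsReachable ws′)
       (λ s next sub → next (SubforestsReachable-step sub s)) (λ sub → sub)
       run (SubforestsReachable-replicate k) xs ys σ

IsGFB-node⇒Reachable-children : ∀ {n a b} → IsGFB n (node a b) → Reachable (a ∷ b ∷ [])
IsGFB-node⇒Reachable-children {n} run with Star-unsnoc run
... | inj₂ (ws , run′ , step _ _ _ p _ _) = n , ws , run′ , p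
... | inj₁ leaves≡node = ⊥-elim (replicate-leaf≢[node] n leaves≡node)
  where
  replicate-leaf≢[node] : ∀ m {a b} → replicate m leaf ≢ [ node a b ]
  replicate-leaf≢[node] 0       ()
  replicate-leaf≢[node] (suc m) ()

lemma6 : ∀ (n : ℕ) (Ta Tb : Tree) → 2 ≤ n → IsGFB n (node Ta Tb) →
           (Σ Tree λ S → IsGFB (leaves Ta) S × Ta ≅ S) ×
           (Σ Tree λ S → IsGFB (leaves Tb) S × Tb ≅ S)
lemma6 n Ta Tb _ run =
  (Ta , Reachable-singleton⇒IsGFB (Reachable-++⁻ˡ [ Ta ] children) , ≅-refl Ta) ,
  (Tb , Reachable-singleton⇒IsGFB (Reachable-++⁻ˡ [ Tb ] children′) , ≅-refl Tb)
  where
  children : Reachable (Ta ∷ Tb ∷ [])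
  children = IsGFB-node⇒Reachable-children run
  children′ : Reachable (Tb ∷ Ta ∷ [])
  children′ = Reachable-resp-↭ (swap Ta Tb ↭-refl) children
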